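{- For each $k\ge2$ and $n\ge1$, $D'_{k,\lceil k/2\rceil\lfloor k/2\rfloor n,\,n}\ge C_{\lceil k/2\rceil,n}\,C_{\lfloor k/2\rfloor,n}$.
   Context: For $j\ge1$, a $j$-dimensional balanced ballot path of length $jn$ is a sequence of $jn$ standard unit vectors of $\mathbb{R}^j$, each $\vec e_i$ occurring exactly $n$ times, such that every intermediate point (partial sum) $\vec x=(x_1,\dots,x_j)$ satisfies $x_1\ge\cdots\ge x_j$; $C_{j,n}$ denotes the number of such paths (the $j$-dimensional Catalan number; $C_{1,n}=1$). The semisymmetric height of $\vec x\in\mathbb{Z}^k_{\ge0}$ is $g_k(\vec x)=\sum_{i=1}^k(k+1-2i)x_i$, and the semisymmetric height of a path is the maximum of $g_k$ over its intermediate points. $D'_{k,u,n}$ denotes the number of $k$-dimensional balanced ballot paths of length $kn$ whose semisymmetric height is exactly $u$. -}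

module Defs where

open import Data.Nat as ℕ using (ℕ; zero; suc; _≥_)
open import Data.Fin as Fin using (Fin; toℕ)
open import Data.Fin.Properties using (all?)
open import Data.Integer as ℤ using (ℤ; +_; _⊔_)
import Data.Integer.Properties as ℤP
open import Data.List as List using (List; []; _∷_; length; filter; allFin; concatMap; map; foldr)
open import Data.List.Relation.Unary.All using (All)
import Data.List.Relation.Unary.All as All
open import Data.List.Relation.Unary.Linked using (Linked)
import Data.List.Relation.Unary.Linked as Linked
open import Data.Vec as Vec using (Vec; toList)
open import Data.Product using (_×_)
open import Relation.Binary.PropositionalEquality using (_≡_)
open import Relation.Nullary using (Dec)
open import Relation.Nullary.Decidable using (_×-dec_)
import Data.Nat.Properties as ℕP
import Data.Fin.Properties as FinP

-- A lattice path in ℤ^j is a word over the alphabet Fin j (letter i = unit vector e_{i+1}).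
Word : ℕ → Set
Word j = List (Fin j)

allWords : (j m : ℕ) → List (Word j)
allWords j zero    = [] ∷ []
allWords j (suc m) = concatMap (λ w → map (λ i → i ∷ w) (allFin j)) (allWords j m)

step : {j : ℕ} → Vec ℕ j → Fin j → Vec ℕ j
step x i = Vec.updateAt x i suc

pointsFrom : {j : ℕ} → Vec ℕ j → Word j → List (Vec ℕ j)
pointsFrom x []      = x ∷ []
pointsFrom x (i ∷ w) = x ∷ pointsFrom (step x i) w

points : {j : ℕ} → Word j → List (Vec ℕ j)
points {j} w = pointsFrom (Vec.replicate j 0) w

Weakly-decreasing : {j : ℕ} → Vec ℕ j → Set
Weakly-decreasing x = Linked _≥_ (toList x)

IsBalancedBallot : (j n : ℕ) → Word j → Set
IsBalancedBallot j n w =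
  ((i : Fin j) → length (filter (i Fin.≟_) w) ≡ n) × All Weakly-decreasing (points w)

isBalancedBallot? : (j n : ℕ) → (w : Word j) → Dec (IsBalancedBallot j n w)
isBalancedBallot? j n w =
  all? (λ i → length (filter (i Fin.≟_) w) ℕ.≟ n)
  ×-dec All.all? (λ x → Linked.linked? ℕP._≥?_ (toList x)) (points w)

C : ℕ → ℕ → ℕ
C j n = length (filter (isBalancedBallot? j n) (allWords j (j ℕ.* n)))

-- semisymmetric height g_k(x) = Σ_{i=1}^k (k+1-2i) x_i  (i 1-based; here i = toℕ f + 1)
g : (k : ℕ) → Vec ℕ k → ℤ
g k x = foldr ℤ._+_ (+ 0)
  (toList (Vec.zipWith (λ f xi → (+ (k ℕ.+ 1) ℤ.- + (2 ℕ.* (toℕ f ℕ.+ 1))) ℤ.* + xi)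
                       (Vec.allFin k) x))

-- semisymmetric height of a path: max of g_k over its intermediate points
-- (the list of points is non-empty, its first element being the origin with g_k = 0,
--  so folding with ⊔ from + 0 gives exactly the maximum)
height : (k : ℕ) → Word k → ℤ
height k w = foldr _⊔_ (+ 0) (map (g k) (points w))

IsBalancedBallotOfHeight : (k u n : ℕ) → Word k → Set
IsBalancedBallotOfHeight k u n w = IsBalancedBallot k n w × height k w ≡ + u

isBalancedBallotOfHeight? : (k u n : ℕ) → (w : Word k) → Dec (IsBalancedBallotOfHeight k u n w)
isBalancedBallotOfHeight? k u n w = isBalancedBallot? k n w ×-dec (height k w ℤ.≟ + u)

D′ : ℕ → ℕ → ℕ → ℕ
D′ k u n = length (filter (isBalancedBallotOfHeight? k u n) (allWords k (k ℕ.* n)))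

-- Split the k coordinates into a first block of a = ⌈k/2⌉ and a second block of b = ⌊k/2⌋.
-- A pair of balanced ballot paths u (dimension a) and v (dimension b) gives the k-dimensional
-- balanced ballot path u ⊕ v that first walks u in the first block and then v in the second;
-- this map is injective.  The weight k + 1 − 2i of g_k is ≥ 0 on the first block and ≤ 0 on the
-- second (this is where |a − b| ≤ 1 is used).  Along u every coordinate stays ≤ n and the second
-- block is 0, along v the first block is n and the second block is ≥ 0, so g_k is maximal at the
-- corner (n,…,n,0,…,0), where it equals n Σ_{i ≤ a} (k + 1 − 2i) = a b n.

module Submission where

open import Defs
open import Data.Nat using (ℕ; zero; suc; _+_; _*_; _≤_; _<_; z≤n; s≤s; ⌈_/2⌉; ⌊_/2⌋)
import Data.Nat.Properties as ℕP
open import Data.Fin as Fin using (Fin; toℕ; _↑ˡ_; _↑ʳ_)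
import Data.Fin.Properties as FinP
open import Data.Vec as Vec using (Vec; []; _∷_; lookup)
import Data.Vec.Properties as VecP
open import Data.Vec.Relation.Binary.Pointwise.Inductive as Pointwise using (Pointwise; []; _∷_)
open import Data.List as List using (List; []; _∷_; _++_; map; filter; length; allFin; cartesianProductWith)
import Data.List.Properties as ListP
open import Data.List.Membership.Propositional using (_∈_)
import Data.List.Membership.Propositional.Properties as ∈P
open import Data.List.Relation.Binary.Subset.Propositional using (_⊆_)
open import Data.List.Relation.Unary.Any using (here; there)
open import Data.List.Relation.Unary.All as All using (All; []; _∷_)
import Data.List.Relation.Unary.All.Properties as AllP
open import Data.List.Relation.Unary.Linked using ([]; [-]; _∷_)
open import Data.List.Relation.Unary.Unique.Propositional using (Unique; []; _∷_)
import Data.List.Relation.Unary.Unique.Propositional.Properties as UniqueP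
open import Data.Integer as ℤ using (ℤ; +_; +≤+; _⊔_)
import Data.Integer.Properties as ℤP
open import Data.Integer.Tactic.RingSolver using (solve-∀)
import Data.Nat.Tactic.RingSolver as ℕ-Ring
open import Data.Product using (_×_; _,_)
open import Data.Sum using (inj₁; inj₂)
open import Data.Empty using (⊥-elim)
open import Function using (id; flip; _∘_)
open import Function.Definitions using (Injective)
open import Relation.Nullary using (yes; no)
open import Relation.Unary using (Decidable)
open import Relation.Binary.PropositionalEquality

private
  variable
    A B X : Set
    a b j n : ℕ

-- Counting words

Injective₂ : (A → B → X) → Set
Injective₂ f = ∀ {x x′ y y′} → f x y ≡ f x′ y′ → x ≡ x′ × y ≡ y′

length-cartesianProductWith : (f : A → B → X) (xs : List A) (ys : List B) →
                              length (cartesianProductWith f xs ys) ≡ length xs * length ys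
length-cartesianProductWith f []       ys = refl
length-cartesianProductWith f (x ∷ xs) ys = begin
  length (map (f x) ys ++ cartesianProductWith f xs ys)         ≡⟨ ListP.length-++ (map (f x) ys) ⟩
  length (map (f x) ys) + length (cartesianProductWith f xs ys) ≡⟨ cong₂ _+_ (ListP.length-map (f x) ys)
                                                                           (length-cartesianProductWith f xs ys) ⟩
  length ys + length xs * length ys                             ∎
  where open ≡-Reasoning

Unique-⊆⇒length≤ : {xs ys : List A} → Unique xs → xs ⊆ ys → length xs ≤ length ys
Unique-⊆⇒length≤ [] _ = z≤n
Unique-⊆⇒length≤ {xs = x ∷ xs} (x≢xs ∷ xs!) xs⊆ys
  with ys₁ , ys₂ , refl ← ∈P.∈-∃++ (xs⊆ys (here refl)) =
  subst (suc (length xs) ≤_) (sym (ListP.length-++-sucʳ ys₁ x ys₂))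
        (s≤s (Unique-⊆⇒length≤ xs! xs⊆ys₁++ys₂))
  where
  xs⊆ys₁++ys₂ : xs ⊆ ys₁ ++ ys₂
  xs⊆ys₁++ys₂ z∈xs with ∈P.∈-++⁻ ys₁ (xs⊆ys (there z∈xs))
  ... | inj₁ z∈ys₁         = ∈P.∈-++⁺ˡ z∈ys₁
  ... | inj₂ (here refl)   = ⊥-elim (All.lookup x≢xs z∈xs refl)
  ... | inj₂ (there z∈ys₂) = ∈P.∈-++⁺ʳ ys₁ z∈ys₂

Unique-image⇒length*length≤ : (f : A → B → X) → Injective₂ f →
                              {xs : List A} {ys : List B} {zs : List X} → Unique xs → Unique ys →
                              (∀ {x y} → x ∈ xs → y ∈ ys → f x y ∈ zs) →
                              length xs * length ys ≤ length zs
Unique-image⇒length*length≤ f f-inj {xs} {ys} {zs} xs! ys! f∈zs =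
  subst (_≤ length zs) (length-cartesianProductWith f xs ys)
        (Unique-⊆⇒length≤ (UniqueP.cartesianProductWith⁺ f f-inj xs! ys!) image⊆zs)
  where
  image⊆zs : cartesianProductWith f xs ys ⊆ zs
  image⊆zs v∈ with x , y , x∈xs , y∈ys , refl ← ∈P.∈-cartesianProductWith⁻ f xs ys v∈ = f∈zs x∈xs y∈ys

concatMap-map≡cartesianProductWith : (f : A → B → X) (xs : List A) (ys : List B) →
                                     List.concatMap (λ x → map (f x) ys) xs ≡ cartesianProductWith f xs ys
concatMap-map≡cartesianProductWith f []       ys = refl
concatMap-map≡cartesianProductWith f (x ∷ xs) ys = cong (map (f x) ys ++_) (concatMap-map≡cartesianProductWith f xs ys)

allWords-suc : ∀ j m → allWords j (suc m) ≡ cartesianProductWith (flip List._∷_) (allWords j m) (allFin j)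
allWords-suc j m = concatMap-map≡cartesianProductWith (flip List._∷_) (allWords j m) (allFin j)

flip-∷-injective₂ : Injective₂ (flip (List._∷_ {A = Fin j}))
flip-∷-injective₂ refl = refl , refl

allWords-unique : ∀ j m → Unique (allWords j m)
allWords-unique j zero    = [] ∷ []
allWords-unique j (suc m) rewrite allWords-suc j m =
  UniqueP.cartesianProductWith⁺ (flip List._∷_) flip-∷-injective₂ (allWords-unique j m) (UniqueP.allFin⁺ j)

∈-allWords⁻ : ∀ j m {w : Word j} → w ∈ allWords j m → length w ≡ m
∈-allWords⁻ j zero    (here refl) = refl
∈-allWords⁻ j (suc m) w∈ rewrite allWords-suc j m
  with w , _ , w∈ , _ , refl ← ∈P.∈-cartesianProductWith⁻ (flip List._∷_) (allWords j m) (allFin j) w∈ =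
  cong suc (∈-allWords⁻ j m w∈)

∈-allWords⁺ : ∀ j (w : Word j) → w ∈ allWords j (length w)
∈-allWords⁺ j []      = here refl
∈-allWords⁺ j (i ∷ w) rewrite allWords-suc j (length w) =
  ∈P.∈-cartesianProductWith⁺ (flip List._∷_) (∈-allWords⁺ j w) (∈P.∈-allFin i)

length-filter-allWords-*-≤ :
  {P : Word a → Set} {Q : Word b → Set} {R : Word j → Set}
  (P? : Decidable P) (Q? : Decidable Q) (R? : Decidable R) {p q r : ℕ}
  (f : Word a → Word b → Word j) → Injective₂ f →
  (∀ {u v} → length u ≡ p → length v ≡ q → P u → Q v → length (f u v) ≡ r × R (f u v)) →
  length (filter P? (allWords a p)) * length (filter Q? (allWords b q)) ≤ length (filter R? (allWords j r))
length-filter-allWords-*-≤ {a} {b} {j} P? Q? R? {p} {q} {r} f f-inj f-good =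
  Unique-image⇒length*length≤ f f-inj
    (UniqueP.filter⁺ P? (allWords-unique a p)) (UniqueP.filter⁺ Q? (allWords-unique b q)) f∈
  where
  f∈ : ∀ {u v} → u ∈ filter P? (allWords a p) → v ∈ filter Q? (allWords b q) → f u v ∈ filter R? (allWords j r)
  f∈ {u} {v} u∈ v∈ with u∈allWords , Pu ← ∈P.∈-filter⁻ P? u∈ | v∈allWords , Qv ← ∈P.∈-filter⁻ Q? v∈
    with length-fuv , Rfuv ← f-good (∈-allWords⁻ a p u∈allWords) (∈-allWords⁻ b q v∈allWords) Pu Qv =
    ∈P.∈-filter⁺ R? (subst (λ m → f u v ∈ allWords j m) length-fuv (∈-allWords⁺ j (f u v))) Rfuv

-- Letter counts and the points of a path

count : Fin j → Word j → ℕ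
count i w = length (filter (i Fin.≟_) w)

Balanced : ℕ → Word j → Set
Balanced n w = ∀ i → count i w ≡ n

count-++ : ∀ (i : Fin j) u v → count i (u ++ v) ≡ count i u + count i v
count-++ i u v = trans (cong length (ListP.filter-++ (i Fin.≟_) u v)) (ListP.length-++ (filter (i Fin.≟_) u))

count-map-injective : {f : Fin a → Fin b} → Injective _≡_ _≡_ f → ∀ i w → count (f i) (map f w) ≡ count i w
count-map-injective f-inj i [] = refl
count-map-injective {f = f} f-inj i (x ∷ w) with i Fin.≟ x | f i Fin.≟ f x
... | yes _    | yes _     = cong suc (count-map-injective f-inj i w)
... | no _     | no _      = count-map-injective f-inj i w
... | yes refl | no fi≢fi  = ⊥-elim (fi≢fi refl)
... | no i≢x   | yes fi≡fx = ⊥-elim (i≢x (f-inj fi≡fx))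

count-map-∉ : (f : Fin a → Fin b) (i : Fin b) → (∀ x → i ≢ f x) → ∀ w → count i (map f w) ≡ 0
count-map-∉ f i i∉f [] = refl
count-map-∉ f i i∉f (x ∷ w) with i Fin.≟ f x
... | yes i≡fx = ⊥-elim (i∉f x i≡fx)
... | no _     = count-map-∉ f i i∉f w

endFrom : Vec ℕ j → Word j → Vec ℕ j
endFrom x []      = x
endFrom x (i ∷ w) = endFrom (step x i) w

lookup-step : ∀ (x : Vec ℕ j) k i w → lookup (step x k) i + count i w ≡ lookup x i + count i (k ∷ w)
lookup-step x k i w with i Fin.≟ k
... | yes refl = trans (cong (_+ count i w) (VecP.lookup∘updateAt i x)) (sym (ℕP.+-suc (lookup x i) (count i w)))
... | no i≢k   = cong (_+ count i w) (VecP.lookup∘updateAt′ i k i≢k x)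

lookup-endFrom : ∀ (x : Vec ℕ j) w i → lookup (endFrom x w) i ≡ lookup x i + count i w
lookup-endFrom x []      i = sym (ℕP.+-identityʳ (lookup x i))
lookup-endFrom x (k ∷ w) i = trans (lookup-endFrom (step x k) w i) (lookup-step x k i w)

endFrom-balanced : ∀ (w : Word j) → Balanced n w → endFrom (Vec.replicate j 0) w ≡ Vec.replicate j n
endFrom-balanced {j} {n} w w-bal =
  trans (sym (VecP.tabulate∘lookup _)) (trans (VecP.tabulate-cong same-entries) (VecP.tabulate∘lookup _))
  where
  same-entries : ∀ i → lookup (endFrom (Vec.replicate j 0) w) i ≡ lookup (Vec.replicate j n) i
  same-entries i = begin
    lookup (endFrom (Vec.replicate j 0) w) i  ≡⟨ lookup-endFrom (Vec.replicate j 0) w i ⟩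
    lookup (Vec.replicate j 0) i + count i w  ≡⟨ cong (_+ count i w) (VecP.lookup-replicate i 0) ⟩
    count i w                                 ≡⟨ w-bal i ⟩
    n                                         ≡⟨ VecP.lookup-replicate i n ⟨
    lookup (Vec.replicate j n) i              ∎
    where open ≡-Reasoning

_≤ᵛ_ : Vec ℕ j → Vec ℕ j → Set
_≤ᵛ_ = Pointwise _≤_

≤ᵛ-refl : {x : Vec ℕ j} → x ≤ᵛ x
≤ᵛ-refl = Pointwise.refl ℕP.≤-refl

≤ᵛ-step : ∀ (x : Vec ℕ j) i → x ≤ᵛ step x i
≤ᵛ-step (x ∷ xs) Fin.zero    = ℕP.n≤1+n x ∷ ≤ᵛ-refl
≤ᵛ-step (x ∷ xs) (Fin.suc i) = ℕP.≤-refl ∷ ≤ᵛ-step xs i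

≤ᵛ-endFrom : ∀ (x : Vec ℕ j) w → x ≤ᵛ endFrom x w
≤ᵛ-endFrom x []      = ≤ᵛ-refl
≤ᵛ-endFrom x (i ∷ w) = Pointwise.trans ℕP.≤-trans (≤ᵛ-step x i) (≤ᵛ-endFrom (step x i) w)

pointsFrom-≤ᵛ-endFrom : ∀ (x : Vec ℕ j) w → All (_≤ᵛ endFrom x w) (pointsFrom x w)
pointsFrom-≤ᵛ-endFrom x []      = ≤ᵛ-refl ∷ []
pointsFrom-≤ᵛ-endFrom x (i ∷ w) = ≤ᵛ-endFrom x (i ∷ w) ∷ pointsFrom-≤ᵛ-endFrom (step x i) w

points-≤ᵛ-balanced : ∀ (w : Word j) → Balanced n w → All (_≤ᵛ Vec.replicate j n) (points w)
points-≤ᵛ-balanced {j} w w-bal =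
  subst (λ e → All (_≤ᵛ e) (points w)) (endFrom-balanced w w-bal) (pointsFrom-≤ᵛ-endFrom (Vec.replicate j 0) w)

All-pointsFrom-++ : {P : Vec ℕ j → Set} (x : Vec ℕ j) (u v : Word j) →
                    All P (pointsFrom x u) → All P (pointsFrom (endFrom x u) v) → All P (pointsFrom x (u ++ v))
All-pointsFrom-++ x []      v _           Pv = Pv
All-pointsFrom-++ x (i ∷ u) v (Px ∷ Pu) Pv = Px ∷ All-pointsFrom-++ (step x i) u v Pu Pv

endFrom-∈-pointsFrom-++ : (x : Vec ℕ j) (u v : Word j) → endFrom x u ∈ pointsFrom x (u ++ v)
endFrom-∈-pointsFrom-++ x []      []      = here refl
endFrom-∈-pointsFrom-++ x []      (_ ∷ _) = here refl
endFrom-∈-pointsFrom-++ x (i ∷ u) v       = there (endFrom-∈-pointsFrom-++ (step x i) u v)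

-- Walking two paths in complementary blocks of coordinates

replicate-+ : ∀ a b (x : A) → Vec.replicate (a + b) x ≡ Vec.replicate a x Vec.++ Vec.replicate b x
replicate-+ zero    b x = refl
replicate-+ (suc a) b x = cong (x ∷_) (replicate-+ a b x)

step-↑ˡ : ∀ (y : Vec ℕ a) (z : Vec ℕ b) i → step (y Vec.++ z) (i ↑ˡ b) ≡ step y i Vec.++ z
step-↑ˡ (x ∷ y) z Fin.zero    = refl
step-↑ˡ (x ∷ y) z (Fin.suc i) = cong (x ∷_) (step-↑ˡ y z i)

step-↑ʳ : ∀ (y : Vec ℕ a) (z : Vec ℕ b) i → step (y Vec.++ z) (a ↑ʳ i) ≡ y Vec.++ step z i
step-↑ʳ []      z i = refl
step-↑ʳ (x ∷ y) z i = cong (x ∷_) (step-↑ʳ y z i)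

pointsFrom-↑ˡ : ∀ (y : Vec ℕ a) (z : Vec ℕ b) u →
                pointsFrom (y Vec.++ z) (map (_↑ˡ b) u) ≡ map (Vec._++ z) (pointsFrom y u)
pointsFrom-↑ˡ y z []      = refl
pointsFrom-↑ˡ y z (i ∷ u) rewrite step-↑ˡ y z i = cong ((y Vec.++ z) ∷_) (pointsFrom-↑ˡ (step y i) z u)

pointsFrom-↑ʳ : ∀ (y : Vec ℕ a) (z : Vec ℕ b) v →
                pointsFrom (y Vec.++ z) (map (a ↑ʳ_) v) ≡ map (y Vec.++_) (pointsFrom z v)
pointsFrom-↑ʳ y z []      = refl
pointsFrom-↑ʳ y z (i ∷ v) rewrite step-↑ʳ y z i = cong ((y Vec.++ z) ∷_) (pointsFrom-↑ʳ y (step z i) v)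

endFrom-↑ˡ : ∀ (y : Vec ℕ a) (z : Vec ℕ b) u → endFrom (y Vec.++ z) (map (_↑ˡ b) u) ≡ endFrom y u Vec.++ z
endFrom-↑ˡ y z []      = refl
endFrom-↑ˡ y z (i ∷ u) rewrite step-↑ˡ y z i = endFrom-↑ˡ (step y i) z u

_⊕_ : Word a → Word b → Word (a + b)
_⊕_ {a} {b} u v = map (_↑ˡ b) u ++ map (a ↑ʳ_) v

↑ˡ≢↑ʳ : ∀ (i : Fin a) (k : Fin b) → i ↑ˡ b ≢ a ↑ʳ k
↑ˡ≢↑ʳ {a} {b} i k eq
  with () ← trans (sym (FinP.splitAt-↑ˡ a i b)) (trans (cong (Fin.splitAt a) eq) (FinP.splitAt-↑ʳ a b k))

⊕-injective₂ : Injective₂ (_⊕_ {a} {b})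
⊕-injective₂ {a}     {x = []}    {[]}                 eq = refl , ListP.map-injective (FinP.↑ʳ-injective a _ _) eq
⊕-injective₂         {x = []}    {i ∷ _} {k ∷ _}      eq = ⊥-elim (↑ˡ≢↑ʳ i k (sym (ListP.∷-injectiveˡ eq)))
⊕-injective₂         {x = i ∷ _} {[]}    {_} {k ∷ _}  eq = ⊥-elim (↑ˡ≢↑ʳ i k (ListP.∷-injectiveˡ eq))
⊕-injective₂ {a} {b} {x = i ∷ u} {i′ ∷ u′}            eq
  with refl , refl ← ⊕-injective₂ {x = u} {u′} (ListP.∷-injectiveʳ eq) =
  cong (_∷ u) (FinP.↑ˡ-injective b i i′ (ListP.∷-injectiveˡ eq)) , refl

length-⊕ : (u : Word a) (v : Word b) → length (u ⊕ v) ≡ length u + length v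
length-⊕ {a} {b} u v = trans (ListP.length-++ (map (_↑ˡ b) u))
                             (cong₂ _+_ (ListP.length-map (_↑ˡ b) u) (ListP.length-map (a ↑ʳ_) v))

⊕-balanced : ∀ (u : Word a) (v : Word b) → Balanced n u → Balanced n v → Balanced n (u ⊕ v)
⊕-balanced {a} {b} {n} u v u-bal v-bal i =
  subst (λ i → count i (u ⊕ v) ≡ n) (FinP.join-splitAt a b i) (count-join (Fin.splitAt a i))
  where
  count-join : ∀ s → count (Fin.join a b s) (u ⊕ v) ≡ n
  count-join (inj₁ x) = begin
    count (x ↑ˡ b) (map (_↑ˡ b) u ++ map (a ↑ʳ_) v)               ≡⟨ count-++ (x ↑ˡ b) (map (_↑ˡ b) u) _ ⟩
    count (x ↑ˡ b) (map (_↑ˡ b) u) + count (x ↑ˡ b) (map (a ↑ʳ_) v) ≡⟨ cong₂ _+_ (count-map-injective (FinP.↑ˡ-injective b _ _) x u)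
                                                                                 (count-map-∉ (a ↑ʳ_) (x ↑ˡ b) (↑ˡ≢↑ʳ x) v) ⟩
    count x u + 0                                                  ≡⟨ ℕP.+-identityʳ _ ⟩
    count x u                                                      ≡⟨ u-bal x ⟩
    n                                                              ∎
    where open ≡-Reasoning
  count-join (inj₂ y) = begin
    count (a ↑ʳ y) (map (_↑ˡ b) u ++ map (a ↑ʳ_) v)               ≡⟨ count-++ (a ↑ʳ y) (map (_↑ˡ b) u) _ ⟩
    count (a ↑ʳ y) (map (_↑ˡ b) u) + count (a ↑ʳ y) (map (a ↑ʳ_) v) ≡⟨ cong₂ _+_ (count-map-∉ (_↑ˡ b) (a ↑ʳ y) (λ x → ↑ˡ≢↑ʳ x y ∘ sym) u)
                                                                                 (count-map-injective (FinP.↑ʳ-injective a _ _) y v) ⟩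
    0 + count y v                                                  ≡⟨ v-bal y ⟩
    n                                                              ∎
    where open ≡-Reasoning

points-+ : ∀ a b (w : Word (a + b)) → points w ≡ pointsFrom (Vec.replicate a 0 Vec.++ Vec.replicate b 0) w
points-+ a b w = cong (λ x → pointsFrom x w) (replicate-+ a b 0)

module _ (u : Word a) (v : Word b) (u-bal : Balanced n u) where

  private
    0ᵃ = Vec.replicate a 0
    0ᵇ = Vec.replicate b 0

  All-points-⊕ : {P : Vec ℕ (a + b) → Set} →
                 All (λ y → P (y Vec.++ 0ᵇ)) (points u) →
                 All (λ z → P (Vec.replicate a n Vec.++ z)) (points v) →
                 All P (points (u ⊕ v))
  All-points-⊕ {P} Pu Pv = subst (All P) (sym (points-+ a b (u ⊕ v)))
    (All-pointsFrom-++ (0ᵃ Vec.++ 0ᵇ) (map (_↑ˡ b) u) (map (a ↑ʳ_) v) first-half second-half)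
    where
    first-half : All P (pointsFrom (0ᵃ Vec.++ 0ᵇ) (map (_↑ˡ b) u))
    first-half rewrite pointsFrom-↑ˡ 0ᵃ 0ᵇ u = AllP.map⁺ Pu
    second-half : All P (pointsFrom (endFrom (0ᵃ Vec.++ 0ᵇ) (map (_↑ˡ b) u)) (map (a ↑ʳ_) v))
    second-half rewrite endFrom-↑ˡ 0ᵃ 0ᵇ u | endFrom-balanced u u-bal | pointsFrom-↑ʳ (Vec.replicate a n) 0ᵇ v =
      AllP.map⁺ Pv

  corner-∈-points-⊕ : Vec.replicate a n Vec.++ 0ᵇ ∈ points (u ⊕ v)
  corner-∈-points-⊕ = subst₂ _∈_ corner (sym (points-+ a b (u ⊕ v)))
    (endFrom-∈-pointsFrom-++ (0ᵃ Vec.++ 0ᵇ) (map (_↑ˡ b) u) (map (a ↑ʳ_) v))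
    where
    corner : endFrom (0ᵃ Vec.++ 0ᵇ) (map (_↑ˡ b) u) ≡ Vec.replicate a n Vec.++ 0ᵇ
    corner = trans (endFrom-↑ˡ 0ᵃ 0ᵇ u) (cong (Vec._++ 0ᵇ) (endFrom-balanced u u-bal))

Weakly-decreasing-++-zeros : ∀ b (y : Vec ℕ a) → Weakly-decreasing y → Weakly-decreasing (y Vec.++ Vec.replicate b 0)
Weakly-decreasing-++-zeros zero          []           _           = []
Weakly-decreasing-++-zeros (suc zero)    []           _           = [-]
Weakly-decreasing-++-zeros (suc (suc b)) []           _           = z≤n ∷ Weakly-decreasing-++-zeros (suc b) [] []
Weakly-decreasing-++-zeros zero          (x ∷ [])     _           = [-]
Weakly-decreasing-++-zeros (suc b)       (x ∷ [])     _           = z≤n ∷ Weakly-decreasing-++-zeros (suc b) [] []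
Weakly-decreasing-++-zeros b             (x ∷ x′ ∷ y) (x≥x′ ∷ wd) = x≥x′ ∷ Weakly-decreasing-++-zeros b (x′ ∷ y) wd

Weakly-decreasing-replicate-++ : ∀ a (z : Vec ℕ b) → Weakly-decreasing z → z ≤ᵛ Vec.replicate b n →
                                 Weakly-decreasing (Vec.replicate a n Vec.++ z)
Weakly-decreasing-replicate-++ zero          z        wd _           = wd
Weakly-decreasing-replicate-++ (suc zero)    []       _  _           = [-]
Weakly-decreasing-replicate-++ (suc zero)    (_ ∷ _)  wd (z₀≤n ∷ _)  = z₀≤n ∷ wd
Weakly-decreasing-replicate-++ (suc (suc a)) z        wd z≤ᵛn        =
  ℕP.≤-refl ∷ Weakly-decreasing-replicate-++ (suc a) z wd z≤ᵛn

⊕-isBalancedBallot : {u : Word a} {v : Word b} → IsBalancedBallot a n u → IsBalancedBallot b n v →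
                     IsBalancedBallot (a + b) n (u ⊕ v)
⊕-isBalancedBallot {a} {b} {n} {u} {v} (u-bal , u-wd) (v-bal , v-wd) =
  ⊕-balanced u v u-bal v-bal ,
  All-points-⊕ u v u-bal (All.map (Weakly-decreasing-++-zeros b _) u-wd)
                         (All.zipWith (λ (wd , ≤n) → Weakly-decreasing-replicate-++ a _ wd ≤n)
                                      (v-wd , points-≤ᵛ-balanced v v-bal))

-- The semisymmetric height as a linear form

linear : (Fin j → ℤ) → Vec ℕ j → ℤ
linear c []       = + 0
linear c (x ∷ xs) = c Fin.zero ℤ.* + x ℤ.+ linear (c ∘ Fin.suc) xs

coefficient : ℕ → ℕ → ℤ
coefficient k i = + (k + 1) ℤ.- + (2 * (i + 1))

g≡linear : ∀ k (x : Vec ℕ k) → g k x ≡ linear (coefficient k ∘ toℕ) x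
g≡linear k = go id
  where
  go : ∀ {m} (t : Fin m → Fin k) (x : Vec ℕ m) →
       List.foldr ℤ._+_ (+ 0) (Vec.toList (Vec.zipWith (λ f xᵢ → coefficient k (toℕ f) ℤ.* + xᵢ) (Vec.tabulate t) x))
       ≡ linear (coefficient k ∘ toℕ ∘ t) x
  go t []       = refl
  go t (x ∷ xs) = cong (λ r → coefficient k (toℕ (t Fin.zero)) ℤ.* + x ℤ.+ r) (go (t ∘ Fin.suc) xs)

linear-++ : ∀ (c : Fin (a + b) → ℤ) (y : Vec ℕ a) (z : Vec ℕ b) →
            linear c (y Vec.++ z) ≡ linear (c ∘ (_↑ˡ b)) y ℤ.+ linear (c ∘ (a ↑ʳ_)) z
linear-++ c []      z = sym (ℤP.+-identityˡ _)
linear-++ c (x ∷ y) z = trans (cong (λ r → c Fin.zero ℤ.* + x ℤ.+ r) (linear-++ (c ∘ Fin.suc) y z))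
                              (sym (ℤP.+-assoc (c Fin.zero ℤ.* + x) _ _))

linear-zeros : ∀ (c : Fin j → ℤ) → linear c (Vec.replicate j 0) ≡ + 0
linear-zeros {zero}  c = refl
linear-zeros {suc j} c = cong₂ ℤ._+_ (ℤP.*-zeroʳ (c Fin.zero)) (linear-zeros (c ∘ Fin.suc))

linear-mono : ∀ (c : Fin j → ℤ) → (∀ i → + 0 ℤ.≤ c i) → ∀ {x y} → x ≤ᵛ y → linear c x ℤ.≤ linear c y
linear-mono c c≥0 []          = ℤP.≤-refl
linear-mono c c≥0 (x≤y ∷ xs≤ys) = ℤP.+-mono-≤
  (ℤP.*-monoˡ-≤-nonNeg (c Fin.zero) {{ℤ.nonNegative (c≥0 Fin.zero)}} (+≤+ x≤y))
  (linear-mono (c ∘ Fin.suc) (c≥0 ∘ Fin.suc) xs≤ys)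

linear-nonpos : ∀ (c : Fin j → ℤ) → (∀ i → c i ℤ.≤ + 0) → ∀ x → linear c x ℤ.≤ + 0
linear-nonpos c c≤0 []       = ℤP.≤-refl
linear-nonpos c c≤0 (x ∷ xs) = ℤP.+-mono-≤
  (subst (c Fin.zero ℤ.* + x ℤ.≤_) (ℤP.*-zeroʳ (c Fin.zero))
         (ℤP.*-monoˡ-≤-nonPos (c Fin.zero) {{ℤ.nonPositive (c≤0 Fin.zero)}} (+≤+ z≤n)))
  (linear-nonpos (c ∘ Fin.suc) (c≤0 ∘ Fin.suc) xs)

linear-replicate-progression : ∀ (c₀ : ℤ) (c : Fin a → ℤ) n → (∀ i → c i ≡ c₀ ℤ.- + 2 ℤ.* + toℕ i) →
                               linear c (Vec.replicate a n) ≡ + n ℤ.* (+ a ℤ.* (c₀ ℤ.- + a ℤ.+ + 1))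
linear-replicate-progression {zero}  c₀ c n _      = sym (ℤP.*-zeroʳ (+ n))
linear-replicate-progression {suc a} c₀ c n c-prog = begin
  c Fin.zero ℤ.* + n ℤ.+ linear (c ∘ Fin.suc) (Vec.replicate a n)
    ≡⟨ cong₂ (λ p q → p ℤ.* + n ℤ.+ q) (trans (c-prog Fin.zero) (first-term c₀))
             (linear-replicate-progression (c₀ ℤ.- + 2) (c ∘ Fin.suc) n tail-prog) ⟩
  c₀ ℤ.* + n ℤ.+ + n ℤ.* (+ a ℤ.* ((c₀ ℤ.- + 2) ℤ.- + a ℤ.+ + 1))
    ≡⟨ sum-step c₀ (+ a) (+ n) ⟩
  + n ℤ.* ((+ 1 ℤ.+ + a) ℤ.* (c₀ ℤ.- (+ 1 ℤ.+ + a) ℤ.+ + 1))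
    ≡⟨ cong (λ s → + n ℤ.* (s ℤ.* (c₀ ℤ.- s ℤ.+ + 1))) (sym (ℤP.pos-+ 1 a)) ⟩
  + n ℤ.* (+ suc a ℤ.* (c₀ ℤ.- + suc a ℤ.+ + 1)) ∎
  where
  open ≡-Reasoning
  first-term : ∀ c₀ → c₀ ℤ.- + 2 ℤ.* + 0 ≡ c₀
  first-term = solve-∀
  shift : ∀ c₀ t → c₀ ℤ.- + 2 ℤ.* (+ 1 ℤ.+ t) ≡ (c₀ ℤ.- + 2) ℤ.- + 2 ℤ.* t
  shift = solve-∀
  sum-step : ∀ c₀ a n → c₀ ℤ.* n ℤ.+ n ℤ.* (a ℤ.* ((c₀ ℤ.- + 2) ℤ.- a ℤ.+ + 1))
                        ≡ n ℤ.* ((+ 1 ℤ.+ a) ℤ.* (c₀ ℤ.- (+ 1 ℤ.+ a) ℤ.+ + 1))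
  sum-step = solve-∀
  tail-prog : ∀ i → c (Fin.suc i) ≡ (c₀ ℤ.- + 2) ℤ.- + 2 ℤ.* + toℕ i
  tail-prog i = trans (c-prog (Fin.suc i))
                      (trans (cong (λ t → c₀ ℤ.- + 2 ℤ.* t) (ℤP.pos-+ 1 (toℕ i))) (shift c₀ (+ toℕ i)))

coefficient-nonneg : ∀ k i → 2 * (i + 1) ≤ k + 1 → + 0 ℤ.≤ coefficient k i
coefficient-nonneg k i h = ℤP.i≤j⇒0≤j-i (+≤+ h)

coefficient-nonpos : ∀ k i → k + 1 ≤ 2 * (i + 1) → coefficient k i ℤ.≤ + 0
coefficient-nonpos k i h = ℤP.i≤j⇒i-j≤0 (+≤+ h)

coefficient-progression : ∀ k i → coefficient k i ≡ (+ (k + 1) ℤ.- + 2) ℤ.- + 2 ℤ.* + i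
coefficient-progression k i =
  trans (cong (λ t → + (k + 1) ℤ.- t) (trans (ℤP.pos-* 2 (i + 1)) (cong (+ 2 ℤ.*_) (ℤP.pos-+ i 1))))
        (distribute (+ (k + 1)) (+ i))
  where
  distribute : ∀ K i → K ℤ.- + 2 ℤ.* (i ℤ.+ + 1) ≡ (K ℤ.- + 2) ℤ.- + 2 ℤ.* i
  distribute = solve-∀

foldr-⊔-attained : ∀ (f : A → ℤ) (xs : List A) {M x} → + 0 ℤ.≤ M → All (λ y → f y ℤ.≤ M) xs →
                   x ∈ xs → f x ≡ M → List.foldr _⊔_ (+ 0) (map f xs) ≡ M
foldr-⊔-attained f xs {M} {x} 0≤M f≤M x∈xs fx≡M = ℤP.≤-antisym (upper xs f≤M) (lower xs x∈xs)
  where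
  upper : ∀ xs → All (λ y → f y ℤ.≤ M) xs → List.foldr _⊔_ (+ 0) (map f xs) ℤ.≤ M
  upper []       []             = 0≤M
  upper (y ∷ xs) (fy≤M ∷ f≤M) = ℤP.⊔-lub fy≤M (upper xs f≤M)
  lower : ∀ xs → x ∈ xs → M ℤ.≤ List.foldr _⊔_ (+ 0) (map f xs)
  lower (y ∷ xs) (here refl)  = subst (ℤ._≤ f y ⊔ _) fx≡M (ℤP.i≤i⊔j (f y) _)
  lower (y ∷ xs) (there x∈xs) = ℤP.≤-trans (lower xs x∈xs) (ℤP.i≤j⊔i (f y) _)

2[i+1]≤a+b+1 : ∀ {i a b} → i < a → a ≤ suc b → 2 * (i + 1) ≤ a + b + 1
2[i+1]≤a+b+1 {i} {a} {b} i<a a≤1+b = begin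
  2 * (i + 1)    ≡⟨ double i ⟩
  suc i + suc i  ≤⟨ ℕP.+-mono-≤ i<a i<a ⟩
  a + a          ≤⟨ ℕP.+-monoʳ-≤ a a≤1+b ⟩
  a + suc b      ≡⟨ shift a b ⟩
  a + b + 1      ∎
  where
  open ℕP.≤-Reasoning
  double : ∀ i → 2 * (i + 1) ≡ suc i + suc i
  double = ℕ-Ring.solve-∀
  shift : ∀ a b → a + suc b ≡ a + b + 1
  shift = ℕ-Ring.solve-∀

a+b+1≤2[a+i+1] : ∀ {a b} i → b ≤ suc a → a + b + 1 ≤ 2 * (a + i + 1)
a+b+1≤2[a+i+1] {a} {b} i b≤1+a = begin
  a + b + 1        ≤⟨ ℕP.+-monoˡ-≤ 1 (ℕP.+-monoʳ-≤ a b≤1+a) ⟩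
  a + suc a + 1    ≡⟨ double a ⟩
  2 * (a + 1)      ≤⟨ ℕP.*-monoʳ-≤ 2 (ℕP.+-monoˡ-≤ 1 (ℕP.m≤m+n a i)) ⟩
  2 * (a + i + 1)  ∎
  where
  open ℕP.≤-Reasoning
  double : ∀ a → a + suc a + 1 ≡ 2 * (a + 1)
  double = ℕ-Ring.solve-∀

linear-coefficient-replicate : ∀ a b n →
  linear (coefficient (a + b) ∘ toℕ ∘ (_↑ˡ b)) (Vec.replicate a n) ≡ + (a * b * n)
linear-coefficient-replicate a b n = begin
  linear (coefficient (a + b) ∘ toℕ ∘ (_↑ˡ b)) (Vec.replicate a n)
    ≡⟨ linear-replicate-progression (+ (a + b + 1) ℤ.- + 2) _ n progression ⟩
  + n ℤ.* (+ a ℤ.* ((+ (a + b + 1) ℤ.- + 2) ℤ.- + a ℤ.+ + 1))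
    ≡⟨ cong (λ t → + n ℤ.* (+ a ℤ.* ((t ℤ.- + 2) ℤ.- + a ℤ.+ + 1)))
            (trans (ℤP.pos-+ (a + b) 1) (cong (λ t → t ℤ.+ + 1) (ℤP.pos-+ a b))) ⟩
  + n ℤ.* (+ a ℤ.* ((+ a ℤ.+ + b ℤ.+ + 1 ℤ.- + 2) ℤ.- + a ℤ.+ + 1))
    ≡⟨ collapse (+ a) (+ b) (+ n) ⟩
  + a ℤ.* + b ℤ.* + n
    ≡⟨ trans (ℤP.pos-* (a * b) n) (cong (λ t → t ℤ.* + n) (ℤP.pos-* a b)) ⟨
  + (a * b * n) ∎
  where
  open ≡-Reasoning
  progression : ∀ i → coefficient (a + b) (toℕ (i ↑ˡ b)) ≡ (+ (a + b + 1) ℤ.- + 2) ℤ.- + 2 ℤ.* + toℕ i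
  progression i = trans (cong (coefficient (a + b)) (FinP.toℕ-↑ˡ i b)) (coefficient-progression (a + b) (toℕ i))
  collapse : ∀ a b n → n ℤ.* (a ℤ.* ((a ℤ.+ b ℤ.+ + 1 ℤ.- + 2) ℤ.- a ℤ.+ + 1)) ≡ a ℤ.* b ℤ.* n
  collapse = solve-∀

module _ {a b : ℕ} (a≤1+b : a ≤ suc b) (b≤1+a : b ≤ suc a) where

  private
    cˡ : Fin a → ℤ
    cˡ = coefficient (a + b) ∘ toℕ ∘ (_↑ˡ b)
    cʳ : Fin b → ℤ
    cʳ = coefficient (a + b) ∘ toℕ ∘ (a ↑ʳ_)

    cˡ-nonneg : ∀ i → + 0 ℤ.≤ cˡ i
    cˡ-nonneg i rewrite FinP.toℕ-↑ˡ i b = coefficient-nonneg (a + b) (toℕ i) (2[i+1]≤a+b+1 (FinP.toℕ<n i) a≤1+b)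

    cʳ-nonpos : ∀ k → cʳ k ℤ.≤ + 0
    cʳ-nonpos k rewrite FinP.toℕ-↑ʳ a k = coefficient-nonpos (a + b) (a + toℕ k) (a+b+1≤2[a+i+1] (toℕ k) b≤1+a)

    g-split : ∀ y z → g (a + b) (y Vec.++ z) ≡ linear cˡ y ℤ.+ linear cʳ z
    g-split y z = trans (g≡linear (a + b) (y Vec.++ z)) (linear-++ (coefficient (a + b) ∘ toℕ) y z)

  height-⊕ : ∀ (u : Word a) (v : Word b) → Balanced n u → height (a + b) (u ⊕ v) ≡ + (a * b * n)
  height-⊕ {n} u v u-bal = trans
    (foldr-⊔-attained (g (a + b)) (points (u ⊕ v)) 0≤M bounded (corner-∈-points-⊕ u v u-bal) g-corner)
    (linear-coefficient-replicate a b n)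
    where
    open ℤP.≤-Reasoning
    M : ℤ
    M = linear cˡ (Vec.replicate a n)
    0≤M : + 0 ℤ.≤ M
    0≤M = subst (+ 0 ℤ.≤_) (sym (linear-coefficient-replicate a b n)) (+≤+ z≤n)
    on-first-half : ∀ y → g (a + b) (y Vec.++ Vec.replicate b 0) ≡ linear cˡ y
    on-first-half y = trans (g-split y _) (trans (cong (λ r → linear cˡ y ℤ.+ r) (linear-zeros cʳ)) (ℤP.+-identityʳ _))
    g-corner : g (a + b) (Vec.replicate a n Vec.++ Vec.replicate b 0) ≡ M
    g-corner = on-first-half (Vec.replicate a n)
    first-half-≤ : ∀ {y} → y ≤ᵛ Vec.replicate a n → g (a + b) (y Vec.++ Vec.replicate b 0) ℤ.≤ M
    first-half-≤ {y} y≤n = begin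
      g (a + b) (y Vec.++ Vec.replicate b 0) ≡⟨ on-first-half y ⟩
      linear cˡ y                            ≤⟨ linear-mono cˡ cˡ-nonneg y≤n ⟩
      M                                      ∎
    second-half-≤ : ∀ z → g (a + b) (Vec.replicate a n Vec.++ z) ℤ.≤ M
    second-half-≤ z = begin
      g (a + b) (Vec.replicate a n Vec.++ z) ≡⟨ g-split (Vec.replicate a n) z ⟩
      M ℤ.+ linear cʳ z                      ≤⟨ ℤP.+-monoʳ-≤ M (linear-nonpos cʳ cʳ-nonpos z) ⟩
      M ℤ.+ + 0                              ≡⟨ ℤP.+-identityʳ M ⟩
      M                                      ∎
    bounded : All (λ p → g (a + b) p ℤ.≤ M) (points (u ⊕ v))
    bounded = All-points-⊕ u v u-bal (All.map first-half-≤ (points-≤ᵛ-balanced u u-bal))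
                                     (All.tabulate (λ {z} _ → second-half-≤ z))

C*C≤D′ : a ≤ suc b → b ≤ suc a → C a n * C b n ≤ D′ (a + b) (a * b * n) n
C*C≤D′ {a} {b} {n} a≤1+b b≤1+a =
  length-filter-allWords-*-≤ (isBalancedBallot? a n) (isBalancedBallot? b n)
    (isBalancedBallotOfHeight? (a + b) (a * b * n) n) _⊕_ ⊕-injective₂ ⊕-good
  where
  ⊕-good : ∀ {u v} → length u ≡ a * n → length v ≡ b * n → IsBalancedBallot a n u → IsBalancedBallot b n v →
           length (u ⊕ v) ≡ (a + b) * n × IsBalancedBallotOfHeight (a + b) (a * b * n) n (u ⊕ v)
  ⊕-good {u} {v} |u| |v| u-ballot@(u-bal , _) v-ballot =
    trans (length-⊕ u v) (trans (cong₂ _+_ |u| |v|) (sym (ℕP.*-distribʳ-+ n a b))) ,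
    ⊕-isBalancedBallot u-ballot v-ballot , height-⊕ a≤1+b b≤1+a u v u-bal

-- The inequality holds for every k and n.
proposition5p3 : (k n : ℕ) → 2 ≤ k → 1 ≤ n →
    C ⌈ k /2⌉ n * C ⌊ k /2⌋ n ≤ D′ k (⌈ k /2⌉ * ⌊ k /2⌋ * n) n
proposition5p3 k n _ _ =
  subst (λ m → C ⌈ k /2⌉ n * C ⌊ k /2⌋ n ≤ D′ m (⌈ k /2⌉ * ⌊ k /2⌋ * n) n) halves-sum
        (C*C≤D′ ⌈k/2⌉≤1+⌊k/2⌋ ⌊k/2⌋≤1+⌈k/2⌉)
  where
  halves-sum : ⌈ k /2⌉ + ⌊ k /2⌋ ≡ k
  halves-sum = trans (ℕP.+-comm ⌈ k /2⌉ ⌊ k /2⌋) (ℕP.⌊n/2⌋+⌈n/2⌉≡n k)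
  ⌈k/2⌉≤1+⌊k/2⌋ : ⌈ k /2⌉ ≤ suc ⌊ k /2⌋
  ⌈k/2⌉≤1+⌊k/2⌋ = ℕP.⌊n/2⌋-mono (ℕP.n≤1+n (suc k))
  ⌊k/2⌋≤1+⌈k/2⌉ : ⌊ k /2⌋ ≤ suc ⌈ k /2⌉
  ⌊k/2⌋≤1+⌈k/2⌉ = ℕP.m≤n⇒m≤1+n (ℕP.⌊n/2⌋≤⌈n/2⌉ k)
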